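{- Let $\mathbf A$ be a finite symmetric relation algebra with a normal representation such that $\mathbf A$ has all $1$-cycles and admits a Siggers behavior. Let $\mathfrak A_0$ be its atom structure and $\mathfrak A_0^b$ its binarisation. Then every binary polymorphism of $\mathfrak A_0^b$ is a polymorphism of $\mathfrak A_0$.
   Context: $\mathbf A=(A;\cup,\bar{\ },0,1,\mathrm{id},\breve{\ },\circ)$ is a relation algebra (Tarski's axioms), symmetric if $\breve a=a$; $A_0$ is its set of atoms; $R=\{(x,y,z)\in A_0^3\mid z\le x\circ y\}$ is the set of allowed triples. $\mathbf A$ has all $1$-cycles if $(a,a,a)\in R$ for all $a$; it admits a Siggers behavior if there is $s\colon A_0^6\to A_0$ preserving $R$, with $s(x_1,\dots,x_6)\in\{x_1,\dots,x_6\}$ and $s(x,x,y,y,z,z)=s(y,z,x,z,x,y)$. A normal representation is a representation that is square, homogeneous and fully universal. The atom structure $\mathfrak A_0$ has domain $A_0$, a unary relation for every subset of $A_0$, the binary relation $\{(a_1,a_2)\mid\breve{a_1}=a_2\}$, and $R$. The binarisation $\mathfrak A_0^b$ has domain $A_0$, a unary relation $U_S$ for each $S\subseteq A_0$, for each $a\in A_0$ the binary relation $R_a=\{(x,y)\in A_0^2\mid (a,x,y)\in R\}$, and a binary relation for every union of relations of the form $R_a$. A polymorphism of a structure is a homomorphism from a finite power of it to itself. -}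

module Defs where

open import Data.Nat using (ℕ)
open import Data.Fin using (Fin)
open import Data.Product using (Σ; ∃; ∃-syntax; _×_; _,_; proj₁; proj₂)
open import Data.Sum using (_⊎_)
open import Data.Empty using (⊥)
open import Relation.Nullary using (¬_)
open import Relation.Binary.PropositionalEquality using (_≡_; _≢_)

infix 2 _⇔_
_⇔_ : Set → Set → Set
P ⇔ Q = (P → Q) × (Q → P)

record RelationAlgebra : Set₁ where
  infixl 6 _∪_
  infixl 7 _∘_
  field
    Carrier : Set
    _∪_     : Carrier → Carrier → Carrier
    ‾_      : Carrier → Carrier
    𝟘 𝟙     : Carrier
    idₐ     : Carrier
    _˘      : Carrier → Carrier
    _∘_     : Carrier → Carrier → Carrier
    ∪-comm      : ∀ a b → a ∪ b ≡ b ∪ a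
    ∪-assoc     : ∀ a b c → (a ∪ b) ∪ c ≡ a ∪ (b ∪ c)
    huntington  : ∀ a b → ‾ (‾ a ∪ b) ∪ ‾ (‾ a ∪ ‾ b) ≡ a
    𝟙-def       : ∀ a → 𝟙 ≡ a ∪ ‾ a
    𝟘-def       : 𝟘 ≡ ‾ 𝟙
    ∘-assoc     : ∀ a b c → (a ∘ b) ∘ c ≡ a ∘ (b ∘ c)
    ∘-distribʳ  : ∀ a b c → (a ∪ b) ∘ c ≡ (a ∘ c) ∪ (b ∘ c)
    ∘-identityʳ : ∀ a → a ∘ idₐ ≡ a
    ˘-involutive : ∀ a → (a ˘) ˘ ≡ a
    ˘-distrib-∪ : ∀ a b → (a ∪ b) ˘ ≡ (a ˘) ∪ (b ˘)
    ˘-distrib-∘ : ∀ a b → (a ∘ b) ˘ ≡ (b ˘) ∘ (a ˘)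
    tarski      : ∀ a b → ((a ˘) ∘ ‾ (a ∘ b)) ∪ ‾ b ≡ ‾ b

  _≤_ : Carrier → Carrier → Set
  a ≤ b = a ∪ b ≡ b

  IsAtom : Carrier → Set
  IsAtom a = (a ≢ 𝟘) × (∀ b → b ≤ a → (b ≡ 𝟘) ⊎ (b ≡ a))

  Atom : Set
  Atom = Σ Carrier IsAtom

  R : Atom → Atom → Atom → Set
  R x y z = proj₁ z ≤ (proj₁ x ∘ proj₁ y)

open RelationAlgebra public

Finite : RelationAlgebra → Set
Finite A = ∃[ n ] Σ (Fin n → Carrier A) (λ e → ∀ a → ∃[ i ] e i ≡ a)

Symmetric : RelationAlgebra → Set
Symmetric A = ∀ a → _˘ A a ≡ a

HasAll1Cycles : RelationAlgebra → Set
HasAll1Cycles A = ∀ (a : Atom A) → R A a a a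

module _ (A : RelationAlgebra) where
  private
    A₀ = Atom A
    ∣_∣ : A₀ → Carrier A
    ∣ x ∣ = proj₁ x

  AdmitsSiggers : Set
  AdmitsSiggers =
    Σ (A₀ → A₀ → A₀ → A₀ → A₀ → A₀ → A₀) λ s →
      (∀ x₁ x₂ x₃ x₄ x₅ x₆ y₁ y₂ y₃ y₄ y₅ y₆ z₁ z₂ z₃ z₄ z₅ z₆ →
         R A x₁ y₁ z₁ → R A x₂ y₂ z₂ → R A x₃ y₃ z₃ →
         R A x₄ y₄ z₄ → R A x₅ y₅ z₅ → R A x₆ y₆ z₆ →
         R A (s x₁ x₂ x₃ x₄ x₅ x₆) (s y₁ y₂ y₃ y₄ y₅ y₆) (s z₁ z₂ z₃ z₄ z₅ z₆))
      × (∀ x₁ x₂ x₃ x₄ x₅ x₆ →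
           let v = ∣ s x₁ x₂ x₃ x₄ x₅ x₆ ∣ in
           (v ≡ ∣ x₁ ∣) ⊎ (v ≡ ∣ x₂ ∣) ⊎ (v ≡ ∣ x₃ ∣) ⊎
           (v ≡ ∣ x₄ ∣) ⊎ (v ≡ ∣ x₅ ∣) ⊎ (v ≡ ∣ x₆ ∣))
      × (∀ x y z → ∣ s x x y y z z ∣ ≡ ∣ s y z x z x y ∣)

  record SquareRepresentation : Set₁ where
    field
      D   : Set
      rel : Carrier A → D → D → Set
      rel-∪   : ∀ a b x y → rel (_∪_ A a b) x y ⇔ (rel a x y ⊎ rel b x y)
      rel-‾   : ∀ a x y → rel (‾_ A a) x y ⇔ ¬ rel a x y
      rel-𝟘   : ∀ x y → rel (𝟘 A) x y ⇔ ⊥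
      rel-𝟙   : ∀ x y → rel (𝟙 A) x y
      rel-id  : ∀ x y → rel (idₐ A) x y ⇔ (x ≡ y)
      rel-˘   : ∀ a x y → rel (_˘ A a) x y ⇔ rel a y x
      rel-∘   : ∀ a b x y → rel (_∘_ A a b) x y ⇔ (∃[ z ] rel a x z × rel b z y)
      rel-inj : ∀ a b → (∀ x y → rel a x y ⇔ rel b x y) → a ≡ b

  module _ (B : SquareRepresentation) where
    open SquareRepresentation B

    -- every isomorphism between finite substructures (given by
    -- enumerations u, v) extends to an automorphism
    Homogeneous : Set
    Homogeneous =
      ∀ (n : ℕ) (u v : Fin n → D) →
        (∀ a i j → rel a (u i) (u j) ⇔ rel a (v i) (v j)) →
        Σ (D → D) λ σ → Σ (D → D) λ τ →
          (∀ x → σ (τ x) ≡ x) × (∀ x → τ (σ x) ≡ x) ×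
          (∀ a x y → rel a x y ⇔ rel a (σ x) (σ y)) ×
          (∀ i → σ (u i) ≡ v i)

    AtomicClosedNetwork : ℕ → Set
    AtomicClosedNetwork n =
      Σ (Fin n → Fin n → A₀) λ λ′ →
        (∀ i → _≤_ A ∣ λ′ i i ∣ (idₐ A)) ×
        (∀ i j → ∣ λ′ j i ∣ ≡ _˘ A ∣ λ′ i j ∣) ×
        (∀ i j k → _≤_ A ∣ λ′ i k ∣ (_∘_ A ∣ λ′ i j ∣ ∣ λ′ j k ∣))

    FullyUniversal : Set
    FullyUniversal =
      ∀ (n : ℕ) (N : AtomicClosedNetwork n) →
        Σ (Fin n → D) λ s → ∀ i j → rel ∣ proj₁ N i j ∣ (s i) (s j)

  HasNormalRepresentation : Set₁
  HasNormalRepresentation =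
    Σ SquareRepresentation λ B → Homogeneous B × FullyUniversal B

  -- Atom structure 𝔄₀ and its binarisation 𝔄₀ᵇ, binary polymorphisms.
  -- Subsets of A₀ are given by predicates on the carrier.

  Rₐ : A₀ → A₀ → A₀ → Set
  Rₐ a x y = R A a x y

  ⋃R : (Carrier A → Set) → A₀ → A₀ → Set
  ⋃R T x y = ∃[ a ] T ∣ a ∣ × Rₐ a x y

  IsBinaryPolymorphismOf𝔄₀ : (A₀ → A₀ → A₀) → Set₁
  IsBinaryPolymorphismOf𝔄₀ f =
    (∀ (S : Carrier A → Set) x y → S ∣ x ∣ → S ∣ y ∣ → S ∣ f x y ∣)
    × (∀ x₁ x₂ y₁ y₂ → _˘ A ∣ x₁ ∣ ≡ ∣ x₂ ∣ → _˘ A ∣ y₁ ∣ ≡ ∣ y₂ ∣ →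
         _˘ A ∣ f x₁ y₁ ∣ ≡ ∣ f x₂ y₂ ∣)
    × (∀ x₁ x₂ x₃ y₁ y₂ y₃ → R A x₁ x₂ x₃ → R A y₁ y₂ y₃ →
         R A (f x₁ y₁) (f x₂ y₂) (f x₃ y₃))

  IsBinaryPolymorphismOf𝔄₀ᵇ : (A₀ → A₀ → A₀) → Set₁
  IsBinaryPolymorphismOf𝔄₀ᵇ f =
    (∀ (S : Carrier A → Set) x y → S ∣ x ∣ → S ∣ y ∣ → S ∣ f x y ∣)
    × (∀ a x₁ x₂ y₁ y₂ → Rₐ a x₁ x₂ → Rₐ a y₁ y₂ →
         Rₐ a (f x₁ y₁) (f x₂ y₂))
    × (∀ (T : Carrier A → Set) x₁ x₂ y₁ y₂ → ⋃R T x₁ x₂ → ⋃R T y₁ y₂ →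
         ⋃R T (f x₁ y₁) (f x₂ y₂))

{-# OPTIONS --safe #-}
-- A binary polymorphism f of 𝔄₀ᵇ preserves every unary relation, so it is conservative:
-- f x y ∈ {x, y}.  In a square representation an atom below id relates only equal
-- atoms, and the domain id ∩ (x ∘ x˘) of an atom x is such an atom relating x to itself,
-- so the union of the R_a with a ≤ id is equality of atoms; preserving it gives
-- preservation of the converse relation, which in a symmetric algebra is equality.
-- For R, symmetry makes allowed triples invariant under all permutations, and by
-- pigeonhole f picks the same argument in two of the three coordinates, which reduces
-- everything to the case where f picks x₁ and x₂.
module Submission where

open import Defs
  using (RelationAlgebra; module RelationAlgebra; Atom; Finite; Symmetric; SquareRepresentation;
         module SquareRepresentation; HasNormalRepresentation; HasAll1Cycles; AdmitsSiggers; ⋃R;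
         IsBinaryPolymorphismOf𝔄₀ᵇ; IsBinaryPolymorphismOf𝔄₀)
open import Data.Product using (∃-syntax; _×_; _,_; proj₁; proj₂)
open import Data.Sum using (_⊎_; inj₁; inj₂; [_,_])
open import Data.Empty using (⊥-elim)
open import Function using (flip)
open import Relation.Nullary using (¬_)
open import Relation.Binary.PropositionalEquality
  using (_≡_; _≢_; refl; sym; trans; cong₂; subst; module ≡-Reasoning)

module SquareRepresentationProperties (A : RelationAlgebra) (B : SquareRepresentation A) where
  open RelationAlgebra A hiding (Atom)
  open SquareRepresentation B

  A₀ : Set
  A₀ = Atom A

  ∣_∣ : A₀ → Carrier
  ∣_∣ = proj₁

  rel-excluded-middle : ∀ a x y → rel a x y ⊎ ¬ rel a x y
  rel-excluded-middle a x y
    with proj₁ (rel-∪ a (‾ a) x y) (subst (λ t → rel t x y) (𝟙-def a) (rel-𝟙 x y))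
  ... | inj₁ r = inj₁ r
  ... | inj₂ r = inj₂ (proj₁ (rel-‾ a x y) r)

  rel-stable : ∀ {a x y} → ¬ ¬ rel a x y → rel a x y
  rel-stable {a} {x} {y} ¬¬r =
    [ (λ r → r) , (λ ¬r → ⊥-elim (¬¬r ¬r)) ] (rel-excluded-middle a x y)

  ¬rel-𝟘 : ∀ {x y} → ¬ rel 𝟘 x y
  ¬rel-𝟘 {x} {y} = proj₁ (rel-𝟘 x y)

  rel-id⇒≡ : ∀ {x y} → rel idₐ x y → x ≡ y
  rel-id⇒≡ {x} {y} = proj₁ (rel-id x y)

  ≤⇒rel⊆ : ∀ {a b x y} → a ≤ b → rel a x y → rel b x y
  ≤⇒rel⊆ {a} {b} {x} {y} a≤b r = subst (λ t → rel t x y) a≤b (proj₂ (rel-∪ a b x y) (inj₁ r))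

  rel⊆⇒≤ : ∀ {a b} → (∀ x y → rel a x y → rel b x y) → a ≤ b
  rel⊆⇒≤ {a} {b} a⊆b = rel-inj (a ∪ b) b λ x y →
    (λ r → [ a⊆b x y , (λ s → s) ] (proj₁ (rel-∪ a b x y) r)) ,
    (λ r → proj₂ (rel-∪ a b x y) (inj₂ r))

  rel-empty⇒≡𝟘 : ∀ {a} → (∀ x y → ¬ rel a x y) → a ≡ 𝟘
  rel-empty⇒≡𝟘 {a} empty = rel-inj a 𝟘 λ x y →
    (λ r → ⊥-elim (empty x y r)) , (λ r → ⊥-elim (¬rel-𝟘 r))

  infixl 7 _∩_
  _∩_ : Carrier → Carrier → Carrier
  a ∩ b = ‾ (‾ a ∪ ‾ b)

  rel-∩ : ∀ {a b x y} → rel a x y → rel b x y → rel (a ∩ b) x y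
  rel-∩ {a} {b} {x} {y} ra rb = proj₂ (rel-‾ _ x y) λ r →
    [ (λ ¬a → proj₁ (rel-‾ a x y) ¬a ra) , (λ ¬b → proj₁ (rel-‾ b x y) ¬b rb) ]
      (proj₁ (rel-∪ (‾ a) (‾ b) x y) r)

  rel-∩ˡ : ∀ {a b x y} → rel (a ∩ b) x y → rel a x y
  rel-∩ˡ {a} {b} {x} {y} r = rel-stable λ ¬ra → proj₁ (rel-‾ _ x y) r
    (proj₂ (rel-∪ (‾ a) (‾ b) x y) (inj₁ (proj₂ (rel-‾ a x y) ¬ra)))

  rel-∩ʳ : ∀ {a b x y} → rel (a ∩ b) x y → rel b x y
  rel-∩ʳ {a} {b} {x} {y} r = rel-stable λ ¬rb → proj₁ (rel-‾ _ x y) r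
    (proj₂ (rel-∪ (‾ a) (‾ b) x y) (inj₂ (proj₂ (rel-‾ b x y) ¬rb)))

  ∩-≤ˡ : ∀ {a b} → (a ∩ b) ≤ a
  ∩-≤ˡ = rel⊆⇒≤ λ _ _ → rel-∩ˡ

  ≤-atom⇒≡ : ∀ {a b} → IsAtom a → b ≤ a → b ≢ 𝟘 → b ≡ a
  ≤-atom⇒≡ (_ , minimal) b≤a b≢𝟘 = [ (λ b≡𝟘 → ⊥-elim (b≢𝟘 b≡𝟘)) , (λ b≡a → b≡a) ] (minimal _ b≤a)

  R-cong : ∀ {a b c a′ b′ c′} → a ≡ a′ → b ≡ b′ → c ≡ c′ → c ≤ (a ∘ b) → c′ ≤ (a′ ∘ b′)
  R-cong refl refl refl r = r

  R-peirce : (a b c : A₀) → R a b c → ∣ b ∣ ≤ (∣ a ∣ ˘ ∘ ∣ c ∣)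
  R-peirce a b c c≤ab = rel⊆⇒≤ λ x y r → rel-∩ʳ (subst (λ t → rel t x y) (sym b∩≡b) r)
    where
    b∩≡b : ∣ b ∣ ∩ (∣ a ∣ ˘ ∘ ∣ c ∣) ≡ ∣ b ∣
    b∩≡b = ≤-atom⇒≡ (proj₂ b) ∩-≤ˡ λ b∩≡𝟘 → proj₁ (proj₂ c) (rel-empty⇒≡𝟘 λ x y rc →
      let (z , rxz , rzy) = proj₁ (rel-∘ ∣ a ∣ ∣ b ∣ x y) (≤⇒rel⊆ c≤ab rc)
          r˘zx = proj₂ (rel-˘ ∣ a ∣ z x) rxz
      in ¬rel-𝟘 (subst (λ t → rel t z y) b∩≡𝟘
           (rel-∩ rzy (proj₂ (rel-∘ (∣ a ∣ ˘) ∣ c ∣ z y) (x , r˘zx , rc)))))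

  dom : Carrier → Carrier
  dom a = idₐ ∩ (a ∘ a ˘)

  dom-≤-id : ∀ {a} → dom a ≤ idₐ
  dom-≤-id = ∩-≤ˡ

  rel-dom : ∀ {a x y} → rel a x y → rel (dom a) x x
  rel-dom {a} {x} {y} r =
    rel-∩ (proj₂ (rel-id x x) refl) (proj₂ (rel-∘ a (a ˘) x x) (y , r , proj₂ (rel-˘ a y x) r))

  rel-dom⁻ : ∀ {a x y} → rel (dom a) x y → x ≡ y × ∃[ z ] rel a x z
  rel-dom⁻ {a} {x} {y} r =
    rel-id⇒≡ (rel-∩ˡ r) , (let (z , rxz , _) = proj₁ (rel-∘ a (a ˘) x y) (rel-∩ʳ r) in z , rxz)

  rel-≤id⇒≡ : ∀ {a x y} → a ≤ idₐ → rel a x y → x ≡ y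
  rel-≤id⇒≡ a≤id r = rel-id⇒≡ (≤⇒rel⊆ a≤id r)

  -- For b ≤ dom a, atomicity of a applied to b ∘ a ≤ a decides between b ≡ 𝟘 and b ≡ dom a.
  dom-isAtom : ∀ {a} → IsAtom a → IsAtom (dom a)
  dom-isAtom {a} (a≢𝟘 , a-minimal) = dom≢𝟘 , minimal
    where
    dom≢𝟘 : dom a ≢ 𝟘
    dom≢𝟘 dom≡𝟘 = a≢𝟘 (rel-empty⇒≡𝟘 λ x y r → ¬rel-𝟘 (subst (λ t → rel t x x) dom≡𝟘 (rel-dom r)))

    minimal : ∀ b → b ≤ dom a → b ≡ 𝟘 ⊎ b ≡ dom a
    minimal b b≤dom = [ (λ e → inj₁ (b∘a≡𝟘⇒b≡𝟘 e)) , (λ e → inj₂ (b∘a≡a⇒b≡dom e)) ]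
                        (a-minimal (b ∘ a) (rel⊆⇒≤ b∘a⊆a))
      where
      b≤id : b ≤ idₐ
      b≤id = rel⊆⇒≤ λ _ _ r → rel-∩ˡ (≤⇒rel⊆ b≤dom r)

      b∘a⊆a : ∀ x y → rel (b ∘ a) x y → rel a x y
      b∘a⊆a x y r = let (z , rxz , rzy) = proj₁ (rel-∘ b a x y) r
                    in subst (λ t → rel a t y) (sym (rel-≤id⇒≡ b≤id rxz)) rzy

      b∘a≡𝟘⇒b≡𝟘 : b ∘ a ≡ 𝟘 → b ≡ 𝟘
      b∘a≡𝟘⇒b≡𝟘 b∘a≡𝟘 = rel-empty⇒≡𝟘 λ x y r →
        let (x≡y , z , raxz) = rel-dom⁻ (≤⇒rel⊆ b≤dom r)
            rayz = subst (λ t → rel a t z) x≡y raxz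
        in ¬rel-𝟘 (subst (λ t → rel t x z) b∘a≡𝟘 (proj₂ (rel-∘ b a x z) (y , r , rayz)))

      b∘a≡a⇒b≡dom : b ∘ a ≡ a → b ≡ dom a
      b∘a≡a⇒b≡dom b∘a≡a = rel-inj b (dom a) λ x y → ≤⇒rel⊆ b≤dom , λ r →
        let (x≡y , z , raxz) = rel-dom⁻ r
            (w , rbxw , _) = proj₁ (rel-∘ b a x z) (subst (λ t → rel t x z) (sym b∘a≡a) raxz)
        in subst (rel b x) (trans (sym (rel-≤id⇒≡ b≤id rbxw)) x≡y) rbxw

  domAtom : A₀ → A₀
  domAtom a = dom ∣ a ∣ , dom-isAtom (proj₂ a)

  R-domAtom : (a : A₀) → R (domAtom a) a a
  R-domAtom a = rel⊆⇒≤ λ x y r → proj₂ (rel-∘ (dom ∣ a ∣) ∣ a ∣ x y) (x , rel-dom r , r)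

  R-≤id⇒≡ : ∀ a u v → ∣ a ∣ ≤ idₐ → R a u v → ∣ v ∣ ≡ ∣ u ∣
  R-≤id⇒≡ a u v a≤id v≤au = ≤-atom⇒≡ (proj₂ u) v≤u (proj₁ (proj₂ v))
    where
    v≤u : ∣ v ∣ ≤ ∣ u ∣
    v≤u = rel⊆⇒≤ λ x y r →
      let (z , raxz , ruzy) = proj₁ (rel-∘ ∣ a ∣ ∣ u ∣ x y) (≤⇒rel⊆ v≤au r)
      in subst (λ t → rel ∣ u ∣ t y) (sym (rel-≤id⇒≡ a≤id raxz)) ruzy

module SymmetricRepresentationProperties
  (A : RelationAlgebra) (symmetric : Symmetric A) (B : SquareRepresentation A) where
  open RelationAlgebra A hiding (Atom)
  open SquareRepresentationProperties A B

  ∘-comm : ∀ a b → a ∘ b ≡ b ∘ a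
  ∘-comm a b = begin
    a ∘ b         ≡⟨ sym (symmetric (a ∘ b)) ⟩
    (a ∘ b) ˘     ≡⟨ ˘-distrib-∘ a b ⟩
    b ˘ ∘ a ˘     ≡⟨ cong₂ _∘_ (symmetric b) (symmetric a) ⟩
    b ∘ a         ∎
    where open ≡-Reasoning

  R-swap₁₂ : ∀ a b c → R a b c → R b a c
  R-swap₁₂ a b c = subst (∣ c ∣ ≤_) (∘-comm ∣ a ∣ ∣ b ∣)

  R-swap₂₃ : ∀ a b c → R a b c → R a c b
  R-swap₂₃ a b c r = subst (λ t → ∣ b ∣ ≤ (t ∘ ∣ c ∣)) (symmetric ∣ a ∣) (R-peirce a b c r)

  R-rotate : ∀ a b c → R a b c → R b c a
  R-rotate a b c r = R-swap₂₃ b a c (R-swap₁₂ a b c r)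

  R-rotate⁻¹ : ∀ a b c → R b c a → R a b c
  R-rotate⁻¹ a b c r = R-rotate c a b (R-rotate b c a r)

flip-isBinaryPolymorphismOf𝔄₀ᵇ : ∀ A f → IsBinaryPolymorphismOf𝔄₀ᵇ A f →
                                 IsBinaryPolymorphismOf𝔄₀ᵇ A (flip f)
flip-isBinaryPolymorphismOf𝔄₀ᵇ _ _ (unary , Rₐ-pres , ⋃R-pres) =
  (λ S x y sx sy → unary S y x sy sx) ,
  (λ a x₁ x₂ y₁ y₂ rx ry → Rₐ-pres a y₁ y₂ x₁ x₂ ry rx) ,
  (λ T x₁ x₂ y₁ y₂ rx ry → ⋃R-pres T y₁ y₂ x₁ x₂ ry rx)

module BinarisationPolymorphism (A : RelationAlgebra) (B : SquareRepresentation A)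
  (f : Atom A → Atom A → Atom A) (P : IsBinaryPolymorphismOf𝔄₀ᵇ A f) where
  open RelationAlgebra A hiding (Atom)
  open SquareRepresentationProperties A B

  conservative : ∀ x y → ∣ f x y ∣ ≡ ∣ x ∣ ⊎ ∣ f x y ∣ ≡ ∣ y ∣
  conservative x y = proj₁ P (λ c → c ≡ ∣ x ∣ ⊎ c ≡ ∣ y ∣) x y (inj₁ refl) (inj₂ refl)

  f-cong : ∀ {x₁ x₂ y₁ y₂} → ∣ x₁ ∣ ≡ ∣ x₂ ∣ → ∣ y₁ ∣ ≡ ∣ y₂ ∣ → ∣ f x₁ y₁ ∣ ≡ ∣ f x₂ y₂ ∣
  f-cong {x₁} {x₂} {y₁} {y₂} e₁ e₂
    with proj₂ (proj₂ P) (_≤ idₐ) x₁ x₂ y₁ y₂ (below-id x₁ x₂ e₁) (below-id y₁ y₂ e₂)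
    where
    below-id : ∀ x x′ → ∣ x ∣ ≡ ∣ x′ ∣ → ⋃R A (_≤ idₐ) x x′
    below-id x _ e = domAtom x , dom-≤-id , R-cong refl refl e (R-domAtom x)
  ... | a , a≤id , r = sym (R-≤id⇒≡ a (f x₁ y₁) (f x₂ y₂) a≤id r)

module SymmetricBinarisationPolymorphisms
  (A : RelationAlgebra) (symmetric : Symmetric A) (B : SquareRepresentation A) where
  open RelationAlgebra A hiding (Atom)
  open SquareRepresentationProperties A B
  open SymmetricRepresentationProperties A symmetric B

  -- If f x₃ y₃ = y₃, the union of R_{x₁} and R_{y₁} yields R(a, f x₂ y₂, f x₃ y₃) for some
  -- a ∈ {x₁, y₁}; when a = y₁, the relation R_{x₂} applied to (x₁, x₃) and (y₁, y₃) concludes.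
  preserves-R-left₁₂ : ∀ f → IsBinaryPolymorphismOf𝔄₀ᵇ A f →
    ∀ x₁ x₂ x₃ y₁ y₂ y₃ → R x₁ x₂ x₃ → R y₁ y₂ y₃ →
    ∣ f x₁ y₁ ∣ ≡ ∣ x₁ ∣ → ∣ f x₂ y₂ ∣ ≡ ∣ x₂ ∣ → R (f x₁ y₁) (f x₂ y₂) (f x₃ y₃)
  preserves-R-left₁₂ f P x₁ x₂ x₃ y₁ y₂ y₃ rx ry e₁ e₂ with conservative x₃ y₃
    where open BinarisationPolymorphism A B f P
  ... | inj₁ e₃ = R-cong (sym e₁) (sym e₂) (sym e₃) rx
  ... | inj₂ e₃ with proj₂ (proj₂ P) (λ c → c ≡ ∣ x₁ ∣ ⊎ c ≡ ∣ y₁ ∣) x₂ x₃ y₂ y₃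
                       (x₁ , inj₁ refl , rx) (y₁ , inj₂ refl , ry)
  ...   | a , inj₁ a≡x₁ , r = R-cong (trans a≡x₁ (sym e₁)) refl refl r
  ...   | a , inj₂ a≡y₁ , r =
          R-cong refl (sym e₂) refl (R-swap₁₂ x₂ (f x₁ y₁) (f x₃ y₃)
            (proj₁ (proj₂ P) x₂ x₁ x₃ y₁ y₃ (R-swap₁₂ x₁ x₂ x₃ rx) (R-swap₁₂ y₁ x₂ y₃ ry₁x₂y₃)))
    where
    ry₁x₂y₃ : R y₁ x₂ y₃
    ry₁x₂y₃ = R-cong a≡y₁ e₂ e₃ r

  preserves-R-right₁₂ : ∀ f → IsBinaryPolymorphismOf𝔄₀ᵇ A f →
    ∀ x₁ x₂ x₃ y₁ y₂ y₃ → R x₁ x₂ x₃ → R y₁ y₂ y₃ →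
    ∣ f x₁ y₁ ∣ ≡ ∣ y₁ ∣ → ∣ f x₂ y₂ ∣ ≡ ∣ y₂ ∣ → R (f x₁ y₁) (f x₂ y₂) (f x₃ y₃)
  preserves-R-right₁₂ f P x₁ x₂ x₃ y₁ y₂ y₃ rx ry =
    preserves-R-left₁₂ (flip f) (flip-isBinaryPolymorphismOf𝔄₀ᵇ A f P) y₁ y₂ y₃ x₁ x₂ x₃ ry rx

  preserves-R : ∀ f → IsBinaryPolymorphismOf𝔄₀ᵇ A f →
    ∀ x₁ x₂ x₃ y₁ y₂ y₃ → R x₁ x₂ x₃ → R y₁ y₂ y₃ → R (f x₁ y₁) (f x₂ y₂) (f x₃ y₃)
  preserves-R f P x₁ x₂ x₃ y₁ y₂ y₃ rx ry
    with conservative x₁ y₁ | conservative x₂ y₂ | conservative x₃ y₃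
    where open BinarisationPolymorphism A B f P
  ... | inj₁ e₁ | inj₁ e₂ | _       = preserves-R-left₁₂ f P x₁ x₂ x₃ y₁ y₂ y₃ rx ry e₁ e₂
  ... | inj₂ e₁ | inj₂ e₂ | _       = preserves-R-right₁₂ f P x₁ x₂ x₃ y₁ y₂ y₃ rx ry e₁ e₂
  ... | inj₁ e₁ | inj₂ _  | inj₁ e₃ = R-swap₂₃ (f x₁ y₁) (f x₃ y₃) (f x₂ y₂)
        (preserves-R-left₁₂ f P x₁ x₃ x₂ y₁ y₃ y₂ (R-swap₂₃ x₁ x₂ x₃ rx) (R-swap₂₃ y₁ y₂ y₃ ry) e₁ e₃)
  ... | inj₂ e₁ | inj₁ _  | inj₂ e₃ = R-swap₂₃ (f x₁ y₁) (f x₃ y₃) (f x₂ y₂)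
        (preserves-R-right₁₂ f P x₁ x₃ x₂ y₁ y₃ y₂ (R-swap₂₃ x₁ x₂ x₃ rx) (R-swap₂₃ y₁ y₂ y₃ ry) e₁ e₃)
  ... | inj₂ _  | inj₁ e₂ | inj₁ e₃ = R-rotate⁻¹ (f x₁ y₁) (f x₂ y₂) (f x₃ y₃)
        (preserves-R-left₁₂ f P x₂ x₃ x₁ y₂ y₃ y₁ (R-rotate x₁ x₂ x₃ rx) (R-rotate y₁ y₂ y₃ ry) e₂ e₃)
  ... | inj₁ _  | inj₂ e₂ | inj₂ e₃ = R-rotate⁻¹ (f x₁ y₁) (f x₂ y₂) (f x₃ y₃)
        (preserves-R-right₁₂ f P x₂ x₃ x₁ y₂ y₃ y₁ (R-rotate x₁ x₂ x₃ rx) (R-rotate y₁ y₂ y₃ ry) e₂ e₃)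

lemmaB7 : (A : RelationAlgebra) → Finite A → Symmetric A →
    HasNormalRepresentation A → HasAll1Cycles A → AdmitsSiggers A →
    (f : Atom A → Atom A → Atom A) →
    IsBinaryPolymorphismOf𝔄₀ᵇ A f → IsBinaryPolymorphismOf𝔄₀ A f
lemmaB7 A _ symmetric (B , _) _ _ f P = proj₁ P , preserves-converse , preserves-R f P
  where
  open RelationAlgebra A using (_˘)
  open SquareRepresentationProperties A B using (∣_∣)
  open BinarisationPolymorphism A B f P
  open SymmetricBinarisationPolymorphisms A symmetric B

  preserves-converse : ∀ x₁ x₂ y₁ y₂ → ∣ x₁ ∣ ˘ ≡ ∣ x₂ ∣ → ∣ y₁ ∣ ˘ ≡ ∣ y₂ ∣ →
                       ∣ f x₁ y₁ ∣ ˘ ≡ ∣ f x₂ y₂ ∣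
  preserves-converse _ _ _ _ e₁ e₂ =
    trans (symmetric _) (f-cong (trans (sym (symmetric _)) e₁) (trans (sym (symmetric _)) e₂))
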